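{- Let $k>t\ge2$ be integers, let $G=(V,E)$ be a graph, and let $\mathcal{Q}^*$ be a $k^-/t$-star packing of $G$ covering the maximum number of vertices, with $V_0^*=V\setminus V(\mathcal{Q}^*)$. Then there exists a $k^-$-star packing $\mathcal{Q}_0$ of $G$ covering the maximum number of vertices among all $k^-$-star packings of $G$ such that $V\setminus V(\mathcal{Q}_0)\subseteq V_0^*$.
   Context: For an integer $\ell\ge1$, an $\ell$-star is a graph with one vertex (center) of degree $\ell$ adjacent to $\ell$ degree-$1$ vertices (satellites). A $k^-$-star is an $\ell$-star with $1\le \ell\le k$. A $k^-$-star packing of $G$ is a set of vertex-disjoint subgraphs of $G$, each a $k^-$-star; a $k^-/t$-star packing is a $k^-$-star packing containing no $t$-star. $V(\mathcal{Q})$ denotes the set of vertices covered by packing $\mathcal{Q}$. -}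

module Defs where

open import Data.Nat using (ℕ; _≤_)
open import Data.Bool using (Bool; true; false)
open import Data.Fin using (Fin)
open import Data.List using (List; _∷_; length; concatMap)
open import Data.List.Relation.Unary.All using (All)
open import Data.List.Relation.Unary.Unique.Propositional using (Unique)
open import Data.List.Membership.Propositional using (_∈_)
open import Data.Product using (_×_)
open import Relation.Binary.PropositionalEquality using (_≡_; _≢_)

record Graph (n : ℕ) : Set where
  field
    adj    : Fin n → Fin n → Bool
    sym    : ∀ u v → adj u v ≡ adj v u
    irrefl : ∀ v → adj v v ≡ false
open Graph public

record Star (n : ℕ) : Set where
  constructor star
  field
    center : Fin n
    sats   : List (Fin n)
open Star public

starVerts : ∀ {n} → Star n → List (Fin n)
starVerts s = center s ∷ sats s

-- s is an ℓ-star subgraph of G with ℓ = length (sats s): satellites distinct and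
-- each adjacent to the center (irreflexivity ensures the center is not a satellite).
IsStarIn : ∀ {n} → Graph n → Star n → Set
IsStarIn G s = Unique (sats s) × All (λ u → adj G (center s) u ≡ true) (sats s)

IsKMinusStar : ∀ {n} → Graph n → ℕ → Star n → Set
IsKMinusStar G k s = IsStarIn G s × (1 ≤ length (sats s)) × (length (sats s) ≤ k)

Packing : ℕ → Set
Packing n = List (Star n)

-- V(Q) as a list; vertex-disjointness is uniqueness of this list.
pverts : ∀ {n} → Packing n → List (Fin n)
pverts Q = concatMap starVerts Q

IsKPacking : ∀ {n} → Graph n → ℕ → Packing n → Set
IsKPacking G k Q = All (IsKMinusStar G k) Q × Unique (pverts Q)

IsKtPacking : ∀ {n} → Graph n → ℕ → ℕ → Packing n → Set
IsKtPacking G k t Q = IsKPacking G k Q × All (λ s → length (sats s) ≢ t) Q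

-- |V(Q)| (valid since the vertex list is duplicate-free in a packing).
covered : ∀ {n} → Packing n → ℕ
covered Q = length (pverts Q)

IsMaxKPacking : ∀ {n} → Graph n → ℕ → Packing n → Set
IsMaxKPacking G k Q = IsKPacking G k Q × (∀ Q' → IsKPacking G k Q' → covered Q' ≤ covered Q)

IsMaxKtPacking : ∀ {n} → Graph n → ℕ → ℕ → Packing n → Set
IsMaxKtPacking G k t Q = IsKtPacking G k t Q × (∀ Q' → IsKtPacking G k t Q' → covered Q' ≤ covered Q)

{-# OPTIONS --safe #-}
module Submission where

-- Take a k⁻-star packing B maximising first the
-- number of covered vertices and then the number of its edges that are edges of Q.  If B
-- missed a vertex v of Q, let w be a Q-neighbour of v; a change near w would improve B:
-- if w is uncovered, add the edge wv; if w is a satellite, detach it and make wv a new star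
-- (if its star was the single edge cw, re-centre it as the 2-star with centre w and
-- satellites c, v); if w is a centre, extend its star by v when there is room, and otherwise
-- swap v for a satellite that is not a Q-neighbour of w, which exists because w has at most
-- k Q-neighbours, one of them v.  Every case covers more vertices or gains a shared edge.

open import Defs
open import Data.Nat using (ℕ; _≤_; _<_)
open import Data.Fin using (Fin)
open import Data.Product using (Σ; _×_)
open import Data.List.Membership.Propositional using (_∈_; _∉_)

open import Data.Bool using (true)
import Data.Bool as Bool
open import Data.Fin using (_≟_)
open import Data.List
  using (List; []; _∷_; [_]; _++_; concatMap; length; map; filter; allFin; cartesianProductWith)
open import Data.List.Extrema.Nat using (argmax; argmax-all; f[xs]≤f[argmax])
open import Data.List.Membership.Propositional using (find)
open import Data.List.Membership.Propositional.Properties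
  using (∈-∃++; ∈-++⁺ˡ; ∈-++⁺ʳ; ∈-++⁻; ∈-allFin; ∈-filter⁺; ∈-cartesianProductWith⁺)
open import Data.List.Properties
  using ( length-++; length-filter; length-tabulate; filter-accept; filter-reject; map-++
        ; concatMap-++; ++-identityʳ)
open import Data.List.Relation.Binary.Disjoint.Propositional using (Disjoint)
open import Data.List.Relation.Binary.Permutation.Propositional
  using (_↭_; refl; prep; swap; ↭-sym; ↭-trans; ↭-reflexive; ↭⇒↭ₛ)
open import Data.List.Relation.Binary.Permutation.Propositional.Properties
  using (shift; ↭-length; ∈-resp-↭; All-resp-↭; filter-↭; ++⁺ʳ)
import Data.List.Relation.Binary.Permutation.Setoid.Properties as Permutationₛ
open import Data.List.Relation.Binary.Subset.Propositional using (_⊆_)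
open import Data.List.Relation.Unary.All as All using (All; []; _∷_; all?)
open import Data.List.Relation.Unary.All.Properties using (all-filter; ¬Any⇒All¬; ¬All⇒Any¬)
import Data.List.Relation.Unary.All.Properties as All
open import Data.List.Relation.Unary.AllPairs using ([]; _∷_)
open import Data.List.Relation.Unary.Any using (here; there)
import Data.List.Relation.Unary.Any as Any
open import Data.List.Relation.Unary.Unique.Propositional using (Unique)
import Data.List.Relation.Unary.Unique.Propositional.Properties as Unique
open import Data.Nat using (suc; zero; _*_; _+_; z≤n; s≤s; z<s; _≤?_)
open import Data.Nat.ListAction using (sum)
open import Data.Nat.ListAction.Properties using (sum-++)
open import Data.Nat.Properties
  using ( ≤-refl; ≤-reflexive; ≤-trans; <⇒≤; n≤1+n; m≤n+m; m≤m+n; +-comm; +-mono-≤; +-monoˡ-<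
        ; +-monoʳ-<; *-monoˡ-≤; ≮⇒≥; <⇒≱; module ≤-Reasoning)
open import Data.Nat.Tactic.RingSolver using (solve-∀)
open import Data.Product using (_,_; proj₁; proj₂; ∃-syntax; Σ-syntax)
open import Data.Product.Relation.Binary.Lex.Strict using (×-Lex)
open import Data.Sum using (inj₁; inj₂)
open import Function using (_∘_)
open import Relation.Binary.PropositionalEquality as ≡ using (_≡_; _≢_; cong; subst)
open import Relation.Nullary using (yes; no; contradiction)
open import Relation.Nullary.Decidable using (_×-dec_)
open import Relation.Unary using (Decidable)

private variable
  A : Set
  x : A
  xs ys : List A

Unique-cons : x ∉ xs → Unique xs → Unique (x ∷ xs)
Unique-cons {xs = xs} x∉xs u = ¬Any⇒All¬ xs x∉xs ∷ u

Unique-++⁻ : ∀ xs → Unique (xs ++ ys) → Unique xs × Unique ys × Disjoint xs ys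
Unique-++⁻ [] u = [] , u , λ ()
Unique-++⁻ (x ∷ xs) (x∉ ∷ u) with Unique-++⁻ xs u
... | u-xs , u-ys , xs#ys = All.++⁻ˡ xs x∉ ∷ u-xs , u-ys , disjoint
  where
  disjoint : Disjoint (x ∷ xs) _
  disjoint (here ≡.refl , z∈ys) = All.lookup (All.++⁻ʳ xs x∉) z∈ys ≡.refl
  disjoint (there z∈xs , z∈ys) = xs#ys (z∈xs , z∈ys)

Unique-resp-↭ : xs ↭ ys → Unique xs → Unique ys
Unique-resp-↭ p = Permutationₛ.Unique-resp-↭ (≡.setoid _) (↭⇒↭ₛ p)

∈-∃↭ : x ∈ xs → ∃[ ys ] xs ↭ x ∷ ys
∈-∃↭ {x = x} x∈xs with ∈-∃++ x∈xs
... | as , bs , ≡.refl = as ++ bs , shift x as bs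

Unique⇒length-⊆ : Unique xs → xs ⊆ ys → length xs ≤ length ys
Unique⇒length-⊆ {xs = []} _ _ = z≤n
Unique⇒length-⊆ {xs = x ∷ xs} (x∉xs ∷ u) xs⊆ys with ∈-∃++ (xs⊆ys (here ≡.refl))
... | as , bs , ≡.refl = begin
  suc (length xs)         ≤⟨ s≤s (Unique⇒length-⊆ u xs⊆as++bs) ⟩
  suc (length (as ++ bs)) ≡⟨ ↭-length (shift x as bs) ⟨
  length (as ++ x ∷ bs)   ∎
  where
  open ≤-Reasoning
  xs⊆as++bs : xs ⊆ as ++ bs
  xs⊆as++bs z∈xs = Any.tail (λ z≡x → All.lookup x∉xs z∈xs (≡.sym z≡x))
                            (∈-resp-↭ (shift x as bs) (xs⊆ys (there z∈xs)))

listsUpTo : List A → ℕ → List (List A)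
listsUpTo xs zero    = [ [] ]
listsUpTo xs (suc ℓ) = [] ∷ cartesianProductWith _∷_ xs (listsUpTo xs ℓ)

∈-listsUpTo⁺ : ∀ {ℓ} → All (_∈ xs) ys → length ys ≤ ℓ → ys ∈ listsUpTo xs ℓ
∈-listsUpTo⁺ {ℓ = zero}  []               _           = here ≡.refl
∈-listsUpTo⁺ {ℓ = suc ℓ} []               _           = here ≡.refl
∈-listsUpTo⁺ {ℓ = suc ℓ} (y∈xs ∷ ys⊆xs) (s≤s len≤ℓ) =
  there (∈-cartesianProductWith⁺ _∷_ y∈xs (∈-listsUpTo⁺ ys⊆xs len≤ℓ))

_<ₗₑₓ_ : ℕ × ℕ → ℕ × ℕ → Set
_<ₗₑₓ_ = ×-Lex _≡_ _<_ _<_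

<ₗₑₓ⇒weighted< : ∀ {c a c′ a′ N} → a < N → (c , a) <ₗₑₓ (c′ , a′) →
                 c * N + a < c′ * N + a′
<ₗₑₓ⇒weighted< {c} {a} {c′} {a′} {N} a<N (inj₁ c<c′) = begin-strict
  c * N + a   <⟨ +-monoʳ-< (c * N) a<N ⟩
  c * N + N   ≡⟨ +-comm (c * N) N ⟩
  suc c * N   ≤⟨ *-monoˡ-≤ N c<c′ ⟩
  c′ * N      ≤⟨ m≤m+n (c′ * N) a′ ⟩
  c′ * N + a′ ∎
  where open ≤-Reasoning
<ₗₑₓ⇒weighted< _ (inj₂ (≡.refl , a<a′)) = +-monoʳ-< _ a<a′

module _ {n : ℕ} where

  open import Data.List.Membership.DecPropositional (_≟_ {n}) using (_∈?_)

  Unique⇒length≤ : {xs : List (Fin n)} → Unique xs → length xs ≤ n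
  Unique⇒length≤ {xs} u =
    subst (length xs ≤_) (length-tabulate {n = n} (λ i → i))
          (Unique⇒length-⊆ u (λ {i} _ → ∈-allFin i))

  pverts-[_] : (s : Star n) → pverts [ s ] ≡ starVerts s
  pverts-[ s ] = ++-identityʳ (starVerts s)

  pverts-++ : (B C : Packing n) → pverts (B ++ C) ≡ pverts B ++ pverts C
  pverts-++ = concatMap-++ starVerts

  covered-++ : (B C : Packing n) → covered (B ++ C) ≡ covered B + covered C
  covered-++ B C = ≡.trans (cong length (pverts-++ B C)) (length-++ (pverts B))

  length≤covered : (B : Packing n) → length B ≤ covered B
  length≤covered []      = z≤n
  length≤covered (b ∷ B) = s≤s (≤-trans (length≤covered B) (begin
    covered B                       ≤⟨ m≤n+m _ _ ⟩
    length (sats b) + covered B     ≡⟨ length-++ (sats b) ⟨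
    length (sats b ++ pverts B)     ∎))
    where open ≤-Reasoning

  stars : List (Star n)
  stars = cartesianProductWith star (allFin n) (listsUpTo (allFin n) n)

  packings : List (Packing n)
  packings = listsUpTo stars n

  ∈-stars : (s : Star n) → Unique (sats s) → s ∈ stars
  ∈-stars (star c S) u = ∈-cartesianProductWith⁺ star (∈-allFin c)
    (∈-listsUpTo⁺ (All.tabulate (λ {i} _ → ∈-allFin i)) (Unique⇒length≤ u))

  ∈-packings : {B : Packing n} → All (Unique ∘ sats) B → Unique (pverts B) → B ∈ packings
  ∈-packings {B} us u =
    ∈-listsUpTo⁺ (All.map (∈-stars _) us) (≤-trans (length≤covered B) (Unique⇒length≤ u))

  starNbrs : Star n → Fin n → List (Fin n)
  starNbrs (star c S) u with u ≟ c | u ∈? S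
  ... | yes _ | _     = S
  ... | no _  | yes _ = [ c ]
  ... | no _  | no _  = []

  nbrsIn : Packing n → Fin n → List (Fin n)
  nbrsIn Q u = concatMap (λ s → starNbrs s u) Q

  starNbrs-center : (c : Fin n) (S : List (Fin n)) → starNbrs (star c S) c ≡ S
  starNbrs-center c S with c ≟ c
  ... | yes _   = ≡.refl
  ... | no c≢c = contradiction ≡.refl c≢c

  starNbrs-sat : {c u : Fin n} {S : List (Fin n)} → u ≢ c → u ∈ S → starNbrs (star c S) u ≡ [ c ]
  starNbrs-sat {c} {u} {S} u≢c u∈S with u ≟ c | u ∈? S
  ... | yes u≡c | _       = contradiction u≡c u≢c
  ... | no _    | yes _   = ≡.refl
  ... | no _    | no u∉S = contradiction u∈S u∉S

  starNbrs-∉ : (s : Star n) {u : Fin n} → u ∉ starVerts s → starNbrs s u ≡ []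
  starNbrs-∉ (star c S) {u} u∉s with u ≟ c | u ∈? S
  ... | yes u≡c | _       = contradiction (here u≡c) u∉s
  ... | no _    | yes u∈S = contradiction (there u∈S) u∉s
  ... | no _    | no _    = ≡.refl

  nbrsIn-∉ : (Q : Packing n) {u : Fin n} → u ∉ pverts Q → nbrsIn Q u ≡ []
  nbrsIn-∉ []      _   = ≡.refl
  nbrsIn-∉ (s ∷ Q) u∉ =
    ≡.cong₂ _++_ (starNbrs-∉ s (u∉ ∘ ∈-++⁺ˡ)) (nbrsIn-∉ Q (u∉ ∘ ∈-++⁺ʳ (starVerts s)))

module Adjacency {n : ℕ} (G : Graph n) where

  private variable
    u v : Fin n

  adj⇒≢ : adj G u v ≡ true → u ≢ v
  adj⇒≢ {u} uv ≡.refl with ≡.trans (≡.sym uv) (irrefl G u)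
  ... | ()

  adj-sym : adj G u v ≡ true → adj G v u ≡ true
  adj-sym {u} {v} uv = ≡.trans (Graph.sym G v u) uv

  Unique-starVerts : {s : Star n} → IsStarIn G s → Unique (starVerts s)
  Unique-starVerts (u , adjs) = All.map adj⇒≢ adjs ∷ u

module StarPackings {n : ℕ} (G : Graph n) (k : ℕ) where

  open import Data.List.Membership.DecPropositional (_≟_ {n}) using (_∈?_)
  open import Data.List.Relation.Unary.Unique.DecPropositional (_≟_ {n}) using (unique?)
  open Adjacency G

  private variable
    u v : Fin n

  star-partner : {s : Star n} → IsKMinusStar G k s → v ∈ starVerts s →
                 ∃[ w ] adj G w v ≡ true × v ∈ starNbrs s w
  star-partner {s = star c []}      (_ , () , _)          (here _)
  star-partner {s = star c (s ∷ S)} ((_ , cs ∷ _) , _)    (here ≡.refl) =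
    s , adj-sym cs , subst (c ∈_) (≡.sym (starNbrs-sat (adj⇒≢ cs ∘ ≡.sym) (here ≡.refl))) (here ≡.refl)
  star-partner {v} {star c S}       ((_ , adjs) , _)      (there v∈S) =
    c , All.lookup adjs v∈S , subst (v ∈_) (≡.sym (starNbrs-center c S)) v∈S

  partner : {Q : Packing n} → All (IsKMinusStar G k) Q → v ∈ pverts Q →
            ∃[ w ] adj G w v ≡ true × v ∈ nbrsIn Q w
  partner {Q = s ∷ Q} (s-ok ∷ Q-ok) v∈ with ∈-++⁻ (starVerts s) v∈
  ... | inj₁ v∈s with star-partner s-ok v∈s
  ...   | w , wv , v∈nbrs = w , wv , ∈-++⁺ˡ v∈nbrs
  partner {Q = s ∷ Q} (s-ok ∷ Q-ok) v∈ | inj₂ v∈Q with partner Q-ok v∈Q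
  ...   | w , wv , v∈nbrs = w , wv , ∈-++⁺ʳ (starNbrs s w) v∈nbrs

  length-starNbrs≤ : {s : Star n} → IsKMinusStar G k s → length (starNbrs s u) ≤ k
  length-starNbrs≤ {u} {star c S} (_ , 1≤ℓ , ℓ≤k) with u ≟ c | u ∈? S
  ... | yes _ | _     = ℓ≤k
  ... | no _  | yes _ = ≤-trans 1≤ℓ ℓ≤k
  ... | no _  | no _  = z≤n

  length-nbrsIn≤ : {Q : Packing n} → IsKPacking G k Q → length (nbrsIn Q u) ≤ k
  length-nbrsIn≤ {Q = []} _ = z≤n
  length-nbrsIn≤ {u} {s ∷ Q} (s-ok ∷ Q-ok , uq) with Unique-++⁻ (starVerts s) uq | u ∈? starVerts s
  ... | _ , _ , s#Q | yes u∈s = begin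
    length (starNbrs s u ++ nbrsIn Q u) ≡⟨ cong (λ ns → length (starNbrs s u ++ ns)) (nbrsIn-∉ Q u∉Q) ⟩
    length (starNbrs s u ++ [])         ≡⟨ cong length (++-identityʳ (starNbrs s u)) ⟩
    length (starNbrs s u)               ≤⟨ length-starNbrs≤ {u} s-ok ⟩
    k                                   ∎
    where
    open ≤-Reasoning
    u∉Q : u ∉ pverts Q
    u∉Q u∈Q = s#Q (u∈s , u∈Q)
  ... | _ , u-Q , _ | no u∉s rewrite starNbrs-∉ s u∉s = length-nbrsIn≤ (Q-ok , u-Q)

  IsKMinusStar? : Decidable (IsKMinusStar G k)
  IsKMinusStar? (star c S) =
    (unique? S ×-dec all? (λ x → adj G c x Bool.≟ true) S) ×-dec (1 ≤? length S) ×-dec (length S ≤? k)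

  IsKPacking? : Decidable (IsKPacking G k)
  IsKPacking? B = all? IsKMinusStar? B ×-dec unique? (pverts B)

  IsKPacking-singleton : {s : Star n} → IsKMinusStar G k s → IsKPacking G k [ s ]
  IsKPacking-singleton {s} s-ok =
    s-ok ∷ [] , subst Unique (≡.sym pverts-[ s ]) (Unique-starVerts (proj₁ s-ok))

  IsKMinusStar-↭ : {c : Fin n} {S S′ : List (Fin n)} → S ↭ S′ →
                   IsKMinusStar G k (star c S) → IsKMinusStar G k (star c S′)
  IsKMinusStar-↭ p ((u , adjs) , 1≤ℓ , ℓ≤k) =
    (Unique-resp-↭ p u , All-resp-↭ p adjs) ,
    subst (1 ≤_) (↭-length p) 1≤ℓ , subst (_≤ k) (↭-length p) ℓ≤k

  edgeStar : adj G u v ≡ true → 1 ≤ k → IsKMinusStar G k (star u [ v ])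
  edgeStar uv 1≤k = (([] ∷ [] , uv ∷ []) , s≤s z≤n , 1≤k)

module Agreement {n : ℕ} (Qs : Packing n) where

  open import Data.List.Membership.DecPropositional (_≟_ {n}) using (_∈?_)

  sharedEdges : Star n → ℕ
  sharedEdges (star c S) = length (filter (_∈? nbrsIn Qs c) S)

  agreement : Packing n → ℕ
  agreement B = sum (map sharedEdges B)

  stats : Packing n → ℕ × ℕ
  stats B = covered B , agreement B

  _≺_ : Packing n → Packing n → Set
  B ≺ C = stats B <ₗₑₓ stats C

  score : Packing n → ℕ
  score B = covered B * suc n + agreement B

  agreement-++ : (B C : Packing n) → agreement (B ++ C) ≡ agreement B + agreement C
  agreement-++ B C = ≡.trans (cong sum (map-++ sharedEdges B C)) (sum-++ (map sharedEdges B) _)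

  score-++ : (B C : Packing n) → score (B ++ C) ≡ score B + score C
  score-++ B C = begin
    covered (B ++ C) * suc n + agreement (B ++ C)
      ≡⟨ ≡.cong₂ (λ c a → c * suc n + a) (covered-++ B C) (agreement-++ B C) ⟩
    (covered B + covered C) * suc n + (agreement B + agreement C)
      ≡⟨ distrib (covered B) (covered C) (agreement B) (agreement C) (suc n) ⟩
    score B + score C ∎
    where
    open ≡.≡-Reasoning
    distrib : ∀ a b c d N → (a + b) * N + (c + d) ≡ (a * N + c) + (b * N + d)
    distrib = solve-∀

  agreement≤covered : (B : Packing n) → agreement B ≤ covered B
  agreement≤covered []             = z≤n
  agreement≤covered (star c S ∷ B) = begin
    sharedEdges (star c S) + agreement B ≤⟨ +-mono-≤ (length-filter _ S) (agreement≤covered B) ⟩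
    length S + covered B                 ≡⟨ length-++ S ⟨
    length (S ++ pverts B)               ≤⟨ n≤1+n _ ⟩
    covered (star c S ∷ B)               ∎
    where open ≤-Reasoning

  -- Agreement is at most n, so weighting coverage by n + 1 makes the score lexicographic.
  ≺⇒score< : {B C : Packing n} → Unique (pverts B) → B ≺ C → score B < score C
  ≺⇒score< {B} u = <ₗₑₓ⇒weighted< (s≤s (≤-trans (agreement≤covered B) (Unique⇒length≤ u)))

  stats-↭ : {c : Fin n} {S S′ : List (Fin n)} → S ↭ S′ → stats [ star c S ] ≡ stats [ star c S′ ]
  stats-↭ {c} p = ≡.cong₂ _,_ (↭-length (prep c (++⁺ʳ [] p)))
                              (cong (_+ 0) (↭-length (filter-↭ (_∈? nbrsIn Qs c) p)))

module LocalSearch {n : ℕ} (G : Graph n) (k : ℕ) (2≤k : 2 ≤ k)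
                   (Qs : Packing n) (Qs-ok : IsKPacking G k Qs)
                   {v w : Fin n} (wv : adj G w v ≡ true) (v∈Nw : v ∈ nbrsIn Qs w) where

  open import Data.List.Membership.DecPropositional (_≟_ {n}) using (_∈?_)
  open Adjacency G
  open StarPackings G k
  open Agreement Qs

  private variable
    c : Fin n
    S S′ : List (Fin n)
    b : Star n
    R : Packing n

  LocalImprovement : Star n → Set
  LocalImprovement b = Σ[ L ∈ Packing n ] IsKPacking G k L × pverts L ⊆ v ∷ starVerts b × [ b ] ≺ L

  grow : {L : Packing n} → IsKMinusStar G k b → v ∉ starVerts b → All (IsKMinusStar G k) L →
         pverts L ↭ v ∷ starVerts b → LocalImprovement b
  grow {b} {L} b-ok v∉b L-ok L↭vb =
    L , (L-ok , Unique-resp-↭ (↭-sym L↭vb) (Unique-cons v∉b (Unique-starVerts (proj₁ b-ok)))) ,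
    (λ z∈L → ∈-resp-↭ L↭vb z∈L) , inj₁ (≤-reflexive (begin
      suc (covered [ b ])        ≡⟨ cong (suc ∘ length) pverts-[ b ] ⟩
      suc (length (starVerts b)) ≡⟨ ↭-length L↭vb ⟨
      covered L                  ∎))
    where open ≡.≡-Reasoning

  extendStar : IsKMinusStar G k (star w S) → suc (length S) ≤ k → v ∉ w ∷ S → LocalImprovement (star w S)
  extendStar {S} b-ok@((u , adjs) , _) room v∉b =
    grow b-ok v∉b (((Unique-cons (v∉b ∘ there) u , wv ∷ adjs) , s≤s z≤n , room) ∷ [])
      (swap w v (↭-reflexive (++-identityʳ S)))

  swapSatellite : {x : Fin n} → IsKMinusStar G k (star w (x ∷ S)) → x ∉ nbrsIn Qs w → v ∉ w ∷ x ∷ S →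
                  LocalImprovement (star w (x ∷ S))
  swapSatellite {S = S} {x = x} ((_ ∷ u , _ ∷ adjs) , _ , ℓ≤k) x∉Nw v∉b =
    [ star w (v ∷ S) ] , IsKPacking-singleton ok , L⊆ , inj₂ (≡.refl , moreShared)
    where
    ok : IsKMinusStar G k (star w (v ∷ S))
    ok = (Unique-cons (v∉b ∘ there ∘ there) u , wv ∷ adjs) , s≤s z≤n , ℓ≤k
    L⊆ : pverts [ star w (v ∷ S) ] ⊆ v ∷ w ∷ x ∷ S
    L⊆ (here z≡w)           = there (here z≡w)
    L⊆ (there (here z≡v))   = here z≡v
    L⊆ (there (there z∈S)) = there (there (there (subst (_ ∈_) (++-identityʳ S) z∈S)))
    moreShared : agreement [ star w (x ∷ S) ] < agreement [ star w (v ∷ S) ]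
    moreShared rewrite filter-reject (_∈? nbrsIn Qs w) {x} {S} x∉Nw
                     | filter-accept (_∈? nbrsIn Qs w) {v} {S} v∈Nw = ≤-refl

  recentre : IsKMinusStar G k (star c [ w ]) → v ∉ c ∷ [ w ] → LocalImprovement (star c [ w ])
  recentre {c} b-ok@((_ , cw ∷ []) , _) v∉b =
    grow b-ok v∉b (ok ∷ []) (↭-trans (swap w c refl) (↭-trans (prep c (swap w v refl)) (swap c v refl)))
    where
    ok : IsKMinusStar G k (star w (c ∷ v ∷ []))
    ok = ((((λ c≡v → v∉b (here (≡.sym c≡v))) ∷ []) ∷ [] ∷ [] , adj-sym cw ∷ wv ∷ []) , s≤s z≤n , 2≤k)

  detachSatellite : {s : Fin n} → IsKMinusStar G k (star c (w ∷ s ∷ S)) → v ∉ c ∷ w ∷ s ∷ S →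
                    LocalImprovement (star c (w ∷ s ∷ S))
  detachSatellite {c} {S} {s} b-ok@((_ ∷ u , _ ∷ adjs) , _ , ℓ≤k) v∉b =
    grow b-ok v∉b (edgeStar wv (<⇒≤ 2≤k) ∷ ((u , adjs) , s≤s z≤n , ≤-trans (n≤1+n _) ℓ≤k) ∷ [])
      (↭-trans (swap w v refl) (prep v (swap w c (prep s (↭-reflexive (++-identityʳ S))))))

  LocalImprovement-↭ : S ↭ S′ →
    (IsKMinusStar G k (star c S′) → v ∉ c ∷ S′ → LocalImprovement (star c S′)) →
    IsKMinusStar G k (star c S) → v ∉ c ∷ S → LocalImprovement (star c S)
  LocalImprovement-↭ {c = c} p improve′ b-ok v∉b
    with improve′ (IsKMinusStar-↭ p b-ok) (v∉b ∘ ∈-resp-↭ (prep c (↭-sym p)))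
  ... | L , L-ok , L⊆ , b′≺L =
    L , L-ok , (λ z∈L → ∈-resp-↭ (prep v (prep c (↭-sym p))) (L⊆ z∈L)) ,
    subst (_<ₗₑₓ stats L) (≡.sym (stats-↭ p)) b′≺L

  centreImprovement : IsKMinusStar G k (star w S) → v ∉ w ∷ S → LocalImprovement (star w S)
  centreImprovement {S} b-ok v∉b with suc (length S) ≤? k | all? (_∈? nbrsIn Qs w) S
  ... | yes room | _ = extendStar b-ok room v∉b
  ... | no full  | yes S⊆Nw =
    contradiction (≤-trans (Unique⇒length-⊆ u-vS vS⊆Nw) (length-nbrsIn≤ Qs-ok)) full
    where
    u-vS : Unique (v ∷ S)
    u-vS = Unique-cons (v∉b ∘ there) (proj₁ (proj₁ b-ok))
    vS⊆Nw : v ∷ S ⊆ nbrsIn Qs w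
    vS⊆Nw (here ≡.refl) = v∈Nw
    vS⊆Nw (there z∈S)   = All.lookup S⊆Nw z∈S
  ... | no _ | no S⊈Nw with find (¬All⇒Any¬ (_∈? nbrsIn Qs w) S S⊈Nw)
  ...   | x , x∈S , x∉Nw with ∈-∃↭ x∈S
  ...     | S′ , S↭xS′ = LocalImprovement-↭ S↭xS′ (λ ok v∉ → swapSatellite ok x∉Nw v∉) b-ok v∉b

  satelliteImprovement : IsKMinusStar G k (star c (w ∷ S)) → v ∉ c ∷ w ∷ S →
                         LocalImprovement (star c (w ∷ S))
  satelliteImprovement {S = []}    = recentre
  satelliteImprovement {S = _ ∷ _} = detachSatellite

  localImprovement : IsKMinusStar G k b → v ∉ starVerts b → w ∈ starVerts b → LocalImprovement b
  localImprovement {star c S} b-ok v∉b (here ≡.refl) = centreImprovement b-ok v∉b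
  localImprovement {star c S} b-ok v∉b (there w∈S) with ∈-∃↭ w∈S
  ... | S′ , S↭wS′ = LocalImprovement-↭ S↭wS′ satelliteImprovement b-ok v∉b

  Improvement : Packing n → Set
  Improvement B = Σ[ B′ ∈ Packing n ] IsKPacking G k B′ × pverts B′ ⊆ w ∷ v ∷ pverts B × score B < score B′

  improve-at : IsKMinusStar G k b → IsKPacking G k R → Disjoint (starVerts b) (pverts R) →
               v ∉ pverts (b ∷ R) → w ∈ starVerts b → Improvement (b ∷ R)
  improve-at {b} {R} b-ok (R-ok , u-R) b#R v∉ w∈b with localImprovement b-ok (v∉ ∘ ∈-++⁺ˡ) w∈b
  ... | L , (L-ok , u-L) , L⊆ , b≺L = L ++ R , (All.++⁺ L-ok R-ok , u-LR) , LR⊆ , score<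
    where
    L#R : Disjoint (pverts L) (pverts R)
    L#R (z∈L , z∈R) with L⊆ z∈L
    ... | here ≡.refl = v∉ (∈-++⁺ʳ (starVerts b) z∈R)
    ... | there z∈b   = b#R (z∈b , z∈R)
    u-LR : Unique (pverts (L ++ R))
    u-LR = subst Unique (≡.sym (pverts-++ L R)) (Unique.++⁺ u-L u-R L#R)
    LR⊆ : pverts (L ++ R) ⊆ w ∷ v ∷ pverts (b ∷ R)
    LR⊆ z∈LR with ∈-++⁻ (pverts L) (subst (_ ∈_) (pverts-++ L R) z∈LR)
    ... | inj₂ z∈R = there (there (∈-++⁺ʳ (starVerts b) z∈R))
    ... | inj₁ z∈L with L⊆ z∈L
    ...   | here z≡v  = there (here z≡v)
    ...   | there z∈b = there (there (∈-++⁺ˡ z∈b))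
    score< : score (b ∷ R) < score (L ++ R)
    score< = begin-strict
      score (b ∷ R)         ≡⟨ score-++ [ b ] R ⟩
      score [ b ] + score R <⟨ +-monoˡ-< (score R) (≺⇒score< {[ b ]} {L} u-b b≺L) ⟩
      score L + score R     ≡⟨ score-++ L R ⟨
      score (L ++ R)        ∎
      where
      open ≤-Reasoning
      u-b = proj₂ (IsKPacking-singleton b-ok)

  improve-past : IsKMinusStar G k b → Disjoint (starVerts b) (pverts R) → v ∉ pverts (b ∷ R) →
                 w ∉ starVerts b → Improvement R → Improvement (b ∷ R)
  improve-past {b} {R} b-ok b#R v∉ w∉b (R′ , (R′-ok , u-R′) , R′⊆ , R<R′) =
    b ∷ R′ , (b-ok ∷ R′-ok , Unique.++⁺ (Unique-starVerts (proj₁ b-ok)) u-R′ b#R′) , bR′⊆ , score<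
    where
    b#R′ : Disjoint (starVerts b) (pverts R′)
    b#R′ (z∈b , z∈R′) with R′⊆ z∈R′
    ... | here ≡.refl         = w∉b z∈b
    ... | there (here ≡.refl) = v∉ (∈-++⁺ˡ z∈b)
    ... | there (there z∈R)   = b#R (z∈b , z∈R)
    bR′⊆ : pverts (b ∷ R′) ⊆ w ∷ v ∷ pverts (b ∷ R)
    bR′⊆ z∈bR′ with ∈-++⁻ (starVerts b) z∈bR′
    ... | inj₁ z∈b = there (there (∈-++⁺ˡ z∈b))
    ... | inj₂ z∈R′ with R′⊆ z∈R′
    ...   | here z≡w            = here z≡w
    ...   | there (here z≡v)    = there (here z≡v)
    ...   | there (there z∈R)   = there (there (∈-++⁺ʳ (starVerts b) z∈R))
    score< : score (b ∷ R) < score (b ∷ R′)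
    score< = begin-strict
      score (b ∷ R)          ≡⟨ score-++ [ b ] R ⟩
      score [ b ] + score R  <⟨ +-monoʳ-< (score [ b ]) R<R′ ⟩
      score [ b ] + score R′ ≡⟨ score-++ [ b ] R′ ⟨
      score (b ∷ R′)         ∎
      where open ≤-Reasoning

  improve : {B : Packing n} → IsKPacking G k B → v ∉ pverts B → Improvement B
  improve {[]} _ _ = [ star w [ v ] ] , IsKPacking-singleton (edgeStar wv (<⇒≤ 2≤k)) , (λ z∈ → z∈) , z<s
  improve {b ∷ R} (b-ok ∷ R-ok , u) v∉ with Unique-++⁻ (starVerts b) u | w ∈? starVerts b
  ... | _ , u-R , b#R | yes w∈b = improve-at {b} {R} b-ok (R-ok , u-R) b#R v∉ w∈b
  ... | _ , u-R , b#R | no w∉b  =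
    improve-past {b} {R} b-ok b#R v∉ w∉b (improve {R} (R-ok , u-R) (v∉ ∘ ∈-++⁺ʳ (starVerts b)))

module MaximumScore {n : ℕ} (G : Graph n) (k : ℕ) (Qs : Packing n) where

  open StarPackings G k
  open Agreement Qs

  best : Packing n
  best = argmax score [] (filter IsKPacking? packings)

  best-ok : IsKPacking G k best
  best-ok = argmax-all score ([] , []) (all-filter IsKPacking? packings)

  score≤best : {B : Packing n} → IsKPacking G k B → score B ≤ score best
  score≤best B-ok@(B-stars , u) = All.lookup (f[xs]≤f[argmax] {f = score} [] _)
    (∈-filter⁺ IsKPacking? (∈-packings (All.map (proj₁ ∘ proj₁) B-stars) u) B-ok)

  best-isMax : IsMaxKPacking G k best
  best-isMax = best-ok , λ B B-ok → ≮⇒≥ λ best<B →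
    <⇒≱ (≺⇒score< {best} {B} (proj₂ best-ok) (inj₁ best<B)) (score≤best B-ok)

  best-covers-Qs : 2 ≤ k → IsKPacking G k Qs → (v : Fin n) → v ∉ pverts best → v ∉ pverts Qs
  best-covers-Qs 2≤k Qs-ok v v∉best v∈Qs with partner (proj₁ Qs-ok) v∈Qs
  ... | w , wv , v∈Nw with LocalSearch.improve G k 2≤k Qs Qs-ok wv v∈Nw best-ok v∉best
  ...   | B′ , B′-ok , _ , best<B′ = <⇒≱ best<B′ (score≤best B′-ok)

lemma8 : (k t : ℕ) → 2 ≤ t → t < k → (n : ℕ) → (G : Graph n) → (Qs : Packing n)
    → IsMaxKtPacking G k t Qs
    → Σ (Packing n) (λ Q0 → IsMaxKPacking G k Q0 × (∀ (v : Fin n) → v ∉ pverts Q0 → v ∉ pverts Qs))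
lemma8 k t 2≤t t<k n G Qs ((Qs-ok , _) , _) =
  best , best-isMax , best-covers-Qs (≤-trans 2≤t (<⇒≤ t<k)) Qs-ok
  where open MaximumScore G k Qs
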